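{- Let $k,n$ be integers with $2\leq k\leq n$, and let $T$ be a tree of order $n$ with exactly $r$ leaves. Then $sdiam_k(T)=n-1$ if and only if $r\leq k$.
   Context: For a connected graph $G$ and $S\subseteq V(G)$, the Steiner distance $d_G(S)$ is the minimum number of edges of a connected subgraph (equivalently, a subtree) of $G$ whose vertex set contains $S$. For $2\leq k\leq |V(G)|$, the Steiner $k$-eccentricity of a vertex $v$ is $e_k(v)=\max\{d_G(S): S\subseteq V(G),\ |S|=k,\ v\in S\}$, and the Steiner $k$-diameter is $sdiam_k(G)=\max\{e_k(v): v\in V(G)\}$, i.e. the maximum of $d_G(S)$ over all $k$-subsets $S$ of $V(G)$. -}

module Defs where

open import Data.Nat using (ℕ; zero; suc; _≤_; _<_; _∸_)
open import Data.Fin using (Fin)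
open import Data.Product using (Σ; ∃; _×_; _,_)
open import Data.List using (List; []; _∷_; length)
open import Data.List.Membership.Propositional using (_∈_)
open import Data.List.Relation.Unary.Unique.Propositional using (Unique)
open import Data.List.Relation.Unary.All using (All)
open import Relation.Binary.PropositionalEquality using (_≡_)
open import Relation.Nullary using (¬_)
open import Data.Sum using (_⊎_)

record Graph (n : ℕ) : Set₁ where
  field
    Adj   : Fin n → Fin n → Set
    sym   : ∀ {u v} → Adj u v → Adj v u
    irrefl : ∀ {u} → ¬ Adj u u

open Graph public

data Walk {n : ℕ} (E : Fin n → Fin n → Set) : Fin n → Fin n → Set where
  here : ∀ {u} → Walk E u u
  step : ∀ {u v w} → E u v → Walk E v w → Walk E u w

verts : ∀ {n} {E : Fin n → Fin n → Set} {u v} → Walk E u v → List (Fin n)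
verts {u = u} here = u ∷ []
verts {u = u} (step _ p) = u ∷ verts p

IsPath : ∀ {n} {E : Fin n → Fin n → Set} {u v} → Walk E u v → Set
IsPath p = Unique (verts p)

Connected : ∀ {n} → Graph n → Set
Connected {n} G = ∀ (u v : Fin n) → Walk (Adj G) u v

-- A cycle: vertices u = v0, v1, ..., vm = u with m ≥ 3, where v1 … vm are
-- pairwise distinct; encoded as an edge u–w plus a path from w back to u of
-- length at least 2 (so the cycle has at least 3 vertices).
Acyclic : ∀ {n} → Graph n → Set
Acyclic {n} G =
  ∀ (u w : Fin n) → Adj G u w → (p : Walk (Adj G) w u) → IsPath p →
    length (verts p) ≤ 2

IsTree : ∀ {n} → Graph n → Set
IsTree G = Connected G × Acyclic G

IsLeaf : ∀ {n} → Graph n → Fin n → Set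
IsLeaf {n} G v = Σ (Fin n) λ w → Adj G v w × (∀ x → Adj G v x → x ≡ w)

NumLeaves : ∀ {n} → Graph n → ℕ → Set
NumLeaves {n} G r = Σ (List (Fin n)) λ L →
  Unique L × length L ≡ r × (∀ v → v ∈ L → IsLeaf G v) × (∀ v → IsLeaf G v → v ∈ L)

-- A set of edges of G, given as a duplicate-free list of ordered pairs
-- with each unordered edge appearing at most once.
Edge : ℕ → Set
Edge n = Fin n × Fin n

data InEdges {n} (H : List (Edge n)) : Fin n → Fin n → Set where
  fwd : ∀ {u v} → (u , v) ∈ H → InEdges H u v
  bwd : ∀ {u v} → (u , v) ∈ H → InEdges H v u

IsEdgeSet : ∀ {n} → Graph n → List (Edge n) → Set
IsEdgeSet G H =
  Unique H ×
  All (λ e → Adj G (Data.Product.proj₁ e) (Data.Product.proj₂ e)) H ×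
  (∀ u v → (u , v) ∈ H → ¬ ((v , u) ∈ H))

-- A subset S of vertices, given as a duplicate-free list; |S| = length.
-- "S is contained in a connected subgraph with m edges": there is a set H of
-- m edges of G such that all vertices of S are mutually connected using only
-- edges of H (the subgraph spanned by H together with S is then connected).
SteinerConn : ∀ {n} → Graph n → List (Fin n) → ℕ → Set
SteinerConn {n} G S m = Σ (List (Edge n)) λ H →
  IsEdgeSet G H × length H ≡ m ×
  (∀ u v → u ∈ S → v ∈ S → Walk (InEdges H) u v)

SteinerDist : ∀ {n} → Graph n → List (Fin n) → ℕ → Set
SteinerDist G S d = SteinerConn G S d × (∀ m → m < d → ¬ SteinerConn G S m)

IsKSubset : ∀ {n} → ℕ → List (Fin n) → Set
IsKSubset k S = Unique S × length S ≡ k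

SteinerDiam : ∀ {n} → Graph n → ℕ → ℕ → Set
SteinerDiam {n} G k D =
  (Σ (List (Fin n)) λ S → IsKSubset k S × SteinerDist G S D) ×
  (∀ S d → IsKSubset k S → SteinerDist G S d → d ≤ D)

-- Root the tree at a vertex ρ, so that its edges are the parent edges v — parent v.
-- If S ∋ ρ contains every leaf, then below every v ≠ ρ hangs a leaf of S, and the route
-- from that leaf to ρ in any subgraph joining S must leave the subtree of v through the
-- edge v — parent v; so such a subgraph has all n − 1 edges, and when r ≤ k the leaves
-- together with k − r further vertices form a k-set at Steiner distance n − 1.
-- Conversely, if a leaf ℓ is missing from S, deleting the edge at ℓ from the tree leaves
-- n − 2 edges that still join S; so a k-set at distance n − 1 contains all r leaves.
module Submission where

open import Defs hiding (sym)
open import Data.Nat using (ℕ; zero; suc; _≤_; _<_; _∸_; z≤n; s≤s; _<?_)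
open import Data.Nat.Properties
  using ( suc-injective; ≤-refl; ≤-reflexive; ≤-trans; ≤-antisym; ≤-pred; <-asym; <⇒≱; ≮⇒≥; 1+n≰n
        ; m≤n⇒m<n∨m≡n; m≤n⇒m⊓n≡m; m≢1+n+m; module ≤-Reasoning)
open import Data.Fin using (Fin; zero; _≟_; punchIn)
open import Data.Fin.Properties using (any?; punchIn-injective; punchInᵢ≢i; punchIn-punchOut)
open import Data.Product using (Σ; ∃; _×_; _,_; proj₁; proj₂)
open import Data.Product.Properties using (≡-dec; ,-injective)
open import Data.Sum using (_⊎_; inj₁; inj₂)
open import Data.Empty using (⊥-elim)
open import Data.List using (List; []; _∷_; length; map; filter; allFin; take; _++_; concatMap)
open import Data.List.Properties using (length-map; length-tabulate; length-take; length-removeAt′; filter-notAll)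
open import Data.List.Extrema.Nat using (argmax; argmax-all; f[xs]≤f[argmax])
open import Data.List.Membership.Propositional using (_∈_; _∉_; _─_; lose)
open import Data.List.Membership.Propositional.Properties
  using (∈-map⁺; ∈-map⁻; ∈-filter⁺; ∈-filter⁻; ∈-allFin; ∈-++⁺ˡ; ∈-++⁺ʳ; ∈-concatMap⁺)
open import Data.List.Relation.Unary.Any using (Any; here; there; index)
open import Data.List.Relation.Unary.All as All using (All; []; _∷_)
import Data.List.Relation.Unary.All.Properties as All
open import Data.List.Relation.Unary.Unique.Propositional using (Unique; []; _∷_)
import Data.List.Relation.Unary.Unique.Propositional.Properties as Unique
open import Relation.Binary.PropositionalEquality
  using (_≡_; _≢_; refl; sym; trans; cong; subst; subst₂; module ≡-Reasoning)
open import Relation.Nullary using (Dec; yes; no; ¬_)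
open import Relation.Nullary.Decidable using (¬?; _×-dec_; _⊎-dec_)
open import Function.Bundles using (_⇔_; mk⇔)

module _ {a} {A : Set a} where

  ∈-─ : ∀ {x z : A} {xs} (x∈xs : x ∈ xs) → z ∈ xs → z ≢ x → z ∈ xs ─ x∈xs
  ∈-─ (here refl) (here refl) z≢x = ⊥-elim (z≢x refl)
  ∈-─ (here refl) (there z∈xs) _ = z∈xs
  ∈-─ (there x∈xs) (here refl) _ = here refl
  ∈-─ (there x∈xs) (there z∈xs) z≢x = there (∈-─ x∈xs z∈xs z≢x)

  unique-⊆⇒length≤ : ∀ {xs ys : List A} → Unique xs → (∀ {z} → z ∈ xs → z ∈ ys) →
                     length xs ≤ length ys
  unique-⊆⇒length≤ {[]} _ _ = z≤n
  unique-⊆⇒length≤ {x ∷ xs} {ys} (x∉xs ∷ xs-unique) xs⊆ys = begin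
      suc (length xs)           ≤⟨ s≤s (unique-⊆⇒length≤ xs-unique xs⊆ys─x) ⟩
      suc (length (ys ─ x∈ys))  ≡⟨ sym (length-removeAt′ ys (index x∈ys)) ⟩
      length ys                 ∎
    where
    open ≤-Reasoning
    x∈ys : x ∈ ys
    x∈ys = xs⊆ys (here refl)
    xs⊆ys─x : ∀ {z} → z ∈ xs → z ∈ ys ─ x∈ys
    xs⊆ys─x z∈xs = ∈-─ x∈ys (xs⊆ys (there z∈xs)) (λ z≡x → All.lookup x∉xs z∈xs (sym z≡x))

  ∈-take-++ˡ : ∀ {x : A} {xs} ys k → length xs ≤ k → x ∈ xs → x ∈ take k (xs ++ ys)
  ∈-take-++ˡ ys (suc k) _ (here x≡y) = here x≡y
  ∈-take-++ˡ ys (suc k) (s≤s |xs|≤k) (there x∈xs) = there (∈-take-++ˡ ys k |xs|≤k x∈xs)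

module _ {n : ℕ} where

  open import Data.List.Membership.DecPropositional (_≟_ {n}) public using (_∈?_)

  _≟ᵉ_ : (e f : Edge n) → Dec (e ≡ f)
  _≟ᵉ_ = ≡-dec _≟_ _≟_

  open import Data.List.Membership.DecPropositional _≟ᵉ_ public using () renaming (_∈?_ to _∈ᵉ?_)

  length-allFin : length (allFin n) ≡ n
  length-allFin = length-tabulate (λ i → i)

  extendToKSubset : ∀ {k} {L : List (Fin n)} → Unique L → length L ≤ k → k ≤ n →
                    Σ (List (Fin n)) λ S → IsKSubset k S × (∀ {v} → v ∈ L → v ∈ S)
  extendToKSubset {k} {L} L-unique |L|≤k k≤n =
    take k (L ++ rest) , (S-unique , |S|≡k) , ∈-take-++ˡ rest k |L|≤k
    where
    outside? : ∀ v → Dec (v ∉ L)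
    outside? v = ¬? (v ∈? L)
    rest : List (Fin n)
    rest = filter outside? (allFin n)
    S-unique : Unique (take k (L ++ rest))
    S-unique = Unique.take⁺ k (Unique.++⁺ L-unique (Unique.filter⁺ outside? (Unique.allFin⁺ n))
                 (λ (v∈L , v∈rest) → proj₂ (∈-filter⁻ outside? {xs = allFin n} v∈rest) v∈L))
    allFin⊆L++rest : ∀ {v} → v ∈ allFin n → v ∈ L ++ rest
    allFin⊆L++rest {v} _ with v ∈? L
    ... | yes v∈L = ∈-++⁺ˡ v∈L
    ... | no v∉L = ∈-++⁺ʳ L (∈-filter⁺ outside? (∈-allFin v) v∉L)
    n≤|L++rest| : n ≤ length (L ++ rest)
    n≤|L++rest| = subst (_≤ length (L ++ rest)) length-allFin
                    (unique-⊆⇒length≤ (Unique.allFin⁺ n) allFin⊆L++rest)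
    |S|≡k : length (take k (L ++ rest)) ≡ k
    |S|≡k = trans (length-take k (L ++ rest)) (m≤n⇒m⊓n≡m (≤-trans k≤n n≤|L++rest|))

others : ∀ {n} → Fin n → List (Fin n)
others {suc n} ρ = map (punchIn ρ) (allFin n)

length-others : ∀ {n} (ρ : Fin n) → length (others ρ) ≡ n ∸ 1
length-others {suc n} ρ = trans (length-map (punchIn ρ) (allFin n)) length-allFin

others-unique : ∀ {n} (ρ : Fin n) → Unique (others ρ)
others-unique {suc n} ρ = Unique.map⁺ (punchIn-injective ρ _ _) (Unique.allFin⁺ n)

∈-others⁺ : ∀ {n} {ρ v : Fin n} → v ≢ ρ → v ∈ others ρ
∈-others⁺ {suc n} {ρ} v≢ρ =
  subst (_∈ others ρ) (punchIn-punchOut (λ ρ≡v → v≢ρ (sym ρ≡v))) (∈-map⁺ (punchIn ρ) (∈-allFin _))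

∈-others⁻ : ∀ {n} {ρ v : Fin n} → v ∈ others ρ → v ≢ ρ
∈-others⁻ {suc n} {ρ} v∈others with ∈-map⁻ (punchIn ρ) v∈others
... | i , _ , refl = punchInᵢ≢i ρ i

module _ {n : ℕ} {E : Fin n → Fin n → Set} where

  lengthʷ : ∀ {u v} → Walk E u v → ℕ
  lengthʷ here = 0
  lengthʷ (step _ p) = suc (lengthʷ p)

  _++ʷ_ : ∀ {u v w} → Walk E u v → Walk E v w → Walk E u w
  here ++ʷ q = q
  step e p ++ʷ q = step e (p ++ʷ q)

  reverseʷ : (∀ {x y} → E x y → E y x) → ∀ {u v} → Walk E u v → Walk E v u
  reverseʷ E-sym here = here
  reverseʷ E-sym (step e p) = reverseʷ E-sym p ++ʷ step (E-sym e) here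

  edges : ∀ {u v} → Walk E u v → List (Edge n)
  edges here = []
  edges (step {u} {v} _ p) = (u , v) ∷ edges p

  edges-steps : ∀ {u v} (p : Walk E u v) → All (λ e → E (proj₁ e) (proj₂ e)) (edges p)
  edges-steps here = []
  edges-steps (step e p) = e ∷ edges-steps p

  suffixPath : ∀ {u x v} (q : Walk E x v) → u ∈ verts q → IsPath q → Σ (Walk E u v) IsPath
  suffixPath here (here refl) q-path = here , q-path
  suffixPath (step e q) (here refl) q-path = step e q , q-path
  suffixPath (step e q) (there u∈q) (_ ∷ q-path) = suffixPath q u∈q q-path

  toPath : ∀ {u v} → Walk E u v → Σ (Walk E u v) IsPath
  toPath here = here , ([] ∷ [])
  toPath {u} (step e p) with toPath p
  ... | q , q-path with u ∈? verts q
  ...   | yes u∈q = suffixPath q u∈q q-path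
  ...   | no u∉q = step e q , All.tabulate (λ v∈q u≡v → u∉q (subst (_∈ verts q) (sym u≡v) v∈q)) ∷ q-path

module _ {n : ℕ} {E E′ : Fin n → Fin n → Set} (f : ∀ {x y} → E x y → E′ x y) where

  mapʷ : ∀ {u v} → Walk E u v → Walk E′ u v
  mapʷ here = here
  mapʷ (step e p) = step (f e) (mapʷ p)

  verts-mapʷ : ∀ {u v} (p : Walk E u v) → verts (mapʷ p) ≡ verts p
  verts-mapʷ here = refl
  verts-mapʷ (step e p) = cong (_ ∷_) (verts-mapʷ p)

module _ {n : ℕ} {H : List (Edge n)} where

  InEdges-sym : ∀ {x y} → InEdges H x y → InEdges H y x
  InEdges-sym (fwd e∈H) = bwd e∈H
  InEdges-sym (bwd e∈H) = fwd e∈H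

  InEdges? : ∀ x y → Dec (InEdges H x y)
  InEdges? x y with (x , y) ∈ᵉ? H | (y , x) ∈ᵉ? H
  ... | yes xy∈H | _ = yes (fwd xy∈H)
  ... | no _ | yes yx∈H = yes (bwd yx∈H)
  ... | no xy∉H | no yx∉H = no λ { (fwd xy∈H) → xy∉H xy∈H ; (bwd yx∈H) → yx∉H yx∈H }

  walkAlong : ∀ {E : Fin n → Fin n → Set} {u v} (p : Walk E u v) →
              (∀ {e} → e ∈ edges p → e ∈ H) → Walk (InEdges H) u v
  walkAlong here _ = here
  walkAlong (step _ p) p⊆H = step (fwd (p⊆H (here refl))) (walkAlong p (λ e∈p → p⊆H (there e∈p)))

  InEdges⇒Adj : ∀ {G : Graph n} → IsEdgeSet G H → ∀ {x y} → InEdges H x y → Adj G x y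
  InEdges⇒Adj (_ , H⊆G , _) (fwd xy∈H) = All.lookup H⊆G xy∈H
  InEdges⇒Adj {G} (_ , H⊆G , _) (bwd yx∈H) = Graph.sym G (All.lookup H⊆G yx∈H)

  IsEdgeSet-filter : ∀ {G : Graph n} {p} {P : Edge n → Set p} (P? : ∀ e → Dec (P e)) →
                     IsEdgeSet G H → IsEdgeSet G (filter P? H)
  IsEdgeSet-filter P? (H-unique , H⊆G , H-oriented) =
      Unique.filter⁺ P? H-unique
    , All.tabulate (λ e∈H′ → All.lookup H⊆G (proj₁ (∈-filter⁻ P? {xs = H} e∈H′)))
    , λ u v uv∈H′ vu∈H′ → H-oriented u v (proj₁ (∈-filter⁻ P? {xs = H} uv∈H′))
                                         (proj₁ (∈-filter⁻ P? {xs = H} vu∈H′))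

module _ {n : ℕ} (ℓ : Fin n) where

  Avoids : Edge n → Set
  Avoids (x , y) = x ≢ ℓ × y ≢ ℓ

  avoids? : ∀ e → Dec (Avoids e)
  avoids? (x , y) = ¬? (x ≟ ℓ) ×-dec ¬? (y ≟ ℓ)

  module _ {H : List (Edge n)} {w : Fin n} (ℓ-pendant : ∀ {x} → InEdges H ℓ x → x ≡ w) where

    private
      keep : ∀ {x y} → InEdges H x y → x ≢ ℓ → y ≢ ℓ → InEdges (filter avoids? H) x y
      keep (fwd xy∈H) x≢ℓ y≢ℓ = fwd (∈-filter⁺ avoids? xy∈H (x≢ℓ , y≢ℓ))
      keep (bwd yx∈H) x≢ℓ y≢ℓ = bwd (∈-filter⁺ avoids? yx∈H (y≢ℓ , x≢ℓ))

    -- A walk can only pass through the pendant vertex ℓ as x — ℓ — x, which is cut out.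
    bypass : ∀ {x y} → Walk (InEdges H) x y → x ≢ ℓ → y ≢ ℓ → Walk (InEdges (filter avoids? H)) x y
    bypassFrom : ∀ {x a y} → Dec (a ≡ ℓ) → InEdges H x a → Walk (InEdges H) a y → x ≢ ℓ → y ≢ ℓ →
                 Walk (InEdges (filter avoids? H)) x y

    bypass here _ _ = here
    bypass (step {v = a} e p) = bypassFrom (a ≟ ℓ) e p

    bypassFrom (no a≢ℓ) e p x≢ℓ y≢ℓ = step (keep e x≢ℓ a≢ℓ) (bypass p a≢ℓ y≢ℓ)
    bypassFrom (yes a≡ℓ) e here _ y≢ℓ = ⊥-elim (y≢ℓ a≡ℓ)
    bypassFrom {x} {y = y} (yes refl) e (step {v = b} e′ q) x≢ℓ y≢ℓ =
      subst (λ z → Walk _ z y) b≡x (bypass q (λ b≡ℓ → x≢ℓ (trans (sym b≡x) b≡ℓ)) y≢ℓ)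
      where
      b≡x : b ≡ x
      b≡x = trans (ℓ-pendant e′) (sym (ℓ-pendant (InEdges-sym e)))

record Arborescence {n : ℕ} (A : Fin n → Fin n → Set) (ρ : Fin n) : Set where
  field
    depth        : Fin n → ℕ
    parent       : Fin n → Fin n
    depth-root   : depth ρ ≡ 0
    parent-step  : ∀ {v} → v ≢ ρ → A v (parent v)
    depth-parent : ∀ {v} → v ≢ ρ → depth v ≡ suc (depth (parent v))

module BreadthFirst {n : ℕ} {A : Fin n → Fin n → Set} (A? : ∀ u v → Dec (A u v)) (ρ : Fin n) where

  Reaches : ℕ → Fin n → Set
  Reaches zero v = v ≡ ρ
  Reaches (suc j) v = Reaches j v ⊎ ∃ λ x → A v x × Reaches j x

  reaches? : ∀ j v → Dec (Reaches j v)
  reaches? zero v = v ≟ ρ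
  reaches? (suc j) v = reaches? j v ⊎-dec any? (λ x → A? v x ×-dec reaches? j x)

  walk⇒Reaches : ∀ {v} (p : Walk A v ρ) → Reaches (lengthʷ p) v
  walk⇒Reaches here = refl
  walk⇒Reaches (step {v = x} a p) = inj₂ (x , a , walk⇒Reaches p)

  Reaches-mono : ∀ {i j v} → i ≤ j → Reaches i v → Reaches j v
  Reaches-mono {j = zero} z≤n r = r
  Reaches-mono {j = suc j} i≤1+j r with m≤n⇒m<n∨m≡n i≤1+j
  ... | inj₁ i<1+j = inj₁ (Reaches-mono (≤-pred i<1+j) r)
  ... | inj₂ refl = r

  Dist : Fin n → ℕ → Set
  Dist v j = Reaches j v × (∀ {i} → i < j → ¬ Reaches i v)

  Dist-unique : ∀ {v i j} → Dist v i → Dist v j → i ≡ j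
  Dist-unique (rᵢ , minᵢ) (rⱼ , minⱼ) = ≤-antisym (≮⇒≥ (λ j<i → minᵢ j<i rⱼ)) (≮⇒≥ (λ i<j → minⱼ i<j rᵢ))

  least : ∀ j {v} → Reaches j v → ∃ (Dist v)
  least zero r = 0 , r , λ ()
  least (suc j) {v} r with reaches? j v
  ... | yes r′ = least j r′
  ... | no ¬r = suc j , r , λ i<1+j rᵢ → ¬r (Reaches-mono (≤-pred i<1+j) rᵢ)

  Dist-parent : ∀ {v j} → Dist v j → v ≢ ρ → ∃ λ x → A v x × Σ ℕ λ i → j ≡ suc i × Dist x i
  Dist-parent {j = zero} (v≡ρ , _) v≢ρ = ⊥-elim (v≢ρ v≡ρ)
  Dist-parent {j = suc i} (inj₁ r , minimal) _ = ⊥-elim (minimal ≤-refl r)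
  Dist-parent {j = suc i} (inj₂ (x , a , rx) , minimal) _ =
    x , a , i , refl , rx , λ i′<i rx′ → minimal (s≤s i′<i) (inj₂ (x , a , rx′))

  arborescence : (∀ v → Walk A v ρ) → Arborescence A ρ
  arborescence walk = record
    { depth = depth
    ; parent = λ v → proj₁ (parentOf v)
    ; depth-root = Dist-unique (depth-Dist ρ) (refl , λ ())
    ; parent-step = λ {v} v≢ρ → proj₁ (proj₂ (parentOf v) v≢ρ)
    ; depth-parent = λ {v} v≢ρ → proj₂ (proj₂ (parentOf v) v≢ρ)
    }
    where
    depth : Fin n → ℕ
    depth v = proj₁ (least _ (walk⇒Reaches (walk v)))

    depth-Dist : ∀ v → Dist v (depth v)
    depth-Dist v = proj₂ (least _ (walk⇒Reaches (walk v)))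

    parentOf : ∀ v → Σ (Fin n) λ x → v ≢ ρ → A v x × depth v ≡ suc (depth x)
    parentOf v with v ≟ ρ
    ... | yes v≡ρ = ρ , λ v≢ρ → ⊥-elim (v≢ρ v≡ρ)
    ... | no v≢ρ with Dist-parent (depth-Dist v) v≢ρ
    ...   | x , a , i , d≡1+i , dx = x , λ _ → a , trans d≡1+i (cong suc (Dist-unique dx (depth-Dist x)))

module ArborescenceProperties {n : ℕ} {A : Fin n → Fin n → Set} {ρ : Fin n} (𝒜 : Arborescence A ρ) where

  open Arborescence 𝒜

  depth≡0⇒root : ∀ {v} → depth v ≡ 0 → v ≡ ρ
  depth≡0⇒root {v} d≡0 with v ≟ ρ
  ... | yes v≡ρ = v≡ρ
  ... | no v≢ρ with trans (sym d≡0) (depth-parent v≢ρ)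
  ...   | ()

  treeEdges : List (Edge n)
  treeEdges = map (λ v → v , parent v) (others ρ)

  length-treeEdges : length treeEdges ≡ n ∸ 1
  length-treeEdges = trans (length-map _ (others ρ)) (length-others ρ)

  ∈-treeEdges⁺ : ∀ {v} → v ≢ ρ → (v , parent v) ∈ treeEdges
  ∈-treeEdges⁺ v≢ρ = ∈-map⁺ _ (∈-others⁺ v≢ρ)

  ∈-treeEdges⁻ : ∀ {x y} → (x , y) ∈ treeEdges → x ≢ ρ × y ≡ parent x
  ∈-treeEdges⁻ xy∈E with ∈-map⁻ _ xy∈E
  ... | x , x∈others , refl = ∈-others⁻ x∈others , refl

  treeEdge-depth : ∀ {x y} → (x , y) ∈ treeEdges → depth x ≡ suc (depth y)
  treeEdge-depth xy∈E with ∈-treeEdges⁻ xy∈E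
  ... | x≢ρ , refl = depth-parent x≢ρ

  treeEdges-edgeSet : ∀ {G : Graph n} → (∀ {x y} → A x y → Adj G x y) → IsEdgeSet G treeEdges
  treeEdges-edgeSet {G} A⇒Adj =
      Unique.map⁺ (λ eq → proj₁ (,-injective eq)) (others-unique ρ)
    , All.tabulate parentAdj
    , λ x y xy∈E yx∈E → m≢1+n+m (depth x)
        (trans (treeEdge-depth xy∈E) (cong suc (treeEdge-depth yx∈E)))
    where
    parentAdj : ∀ {e} → e ∈ treeEdges → Adj G (proj₁ e) (proj₂ e)
    parentAdj {x , y} xy∈E with ∈-treeEdges⁻ xy∈E
    ... | x≢ρ , refl = A⇒Adj (parent-step x≢ρ)

  walkToRoot : ∀ v → Walk (InEdges treeEdges) v ρ
  walkToRoot v = go (depth v) v refl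
    where
    go : ∀ d v → depth v ≡ d → Walk (InEdges treeEdges) v ρ
    go zero v d≡0 = subst (λ z → Walk _ z ρ) (sym (depth≡0⇒root d≡0)) here
    go (suc d) v d≡1+d with v ≟ ρ
    ... | yes refl = here
    ... | no v≢ρ = step (fwd (∈-treeEdges⁺ v≢ρ))
                        (go d (parent v) (suc-injective (trans (sym (depth-parent v≢ρ)) d≡1+d)))

  treeEdges-connected : ∀ u v → Walk (InEdges treeEdges) u v
  treeEdges-connected u v = walkToRoot u ++ʷ reverseʷ InEdges-sym (walkToRoot v)

  deeperEnd : Edge n → Fin n
  deeperEnd (x , y) with depth y <? depth x
  ... | yes _ = x
  ... | no _ = y

  deeperEnd-parentEdge : ∀ {v} → v ≢ ρ → deeperEnd (v , parent v) ≡ v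
  deeperEnd-parentEdge {v} v≢ρ with depth (parent v) <? depth v
  ... | yes _ = refl
  ... | no ≮ = ⊥-elim (≮ (≤-reflexive (sym (depth-parent v≢ρ))))

  deeperEnd-childEdge : ∀ {v} → v ≢ ρ → deeperEnd (parent v , v) ≡ v
  deeperEnd-childEdge {v} v≢ρ with depth v <? depth (parent v)
  ... | yes v<p = ⊥-elim (<-asym v<p (≤-reflexive (sym (depth-parent v≢ρ))))
  ... | no _ = refl

  -- Every non-root vertex is the deeper end of an edge of H.
  parentEdges⊆⇒length≥ : ∀ {H : List (Edge n)} → (∀ {v} → v ≢ ρ → InEdges H v (parent v)) →
                          n ∸ 1 ≤ length H
  parentEdges⊆⇒length≥ {H} covers = begin
      n ∸ 1                   ≡⟨ sym (length-others ρ) ⟩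
      length (others ρ)       ≤⟨ unique-⊆⇒length≤ (others-unique ρ) others⊆ ⟩
      length (map deeperEnd H) ≡⟨ length-map deeperEnd H ⟩
      length H                ∎
    where
    open ≤-Reasoning
    others⊆ : ∀ {v} → v ∈ others ρ → v ∈ map deeperEnd H
    others⊆ v∈others with ∈-others⁻ v∈others
    ... | v≢ρ with covers v≢ρ
    ...   | fwd e∈H = subst (_∈ map deeperEnd H) (deeperEnd-parentEdge v≢ρ) (∈-map⁺ deeperEnd e∈H)
    ...   | bwd e∈H = subst (_∈ map deeperEnd H) (deeperEnd-childEdge v≢ρ) (∈-map⁺ deeperEnd e∈H)

  ancestorsᶠ : ℕ → Fin n → List (Fin n)
  ancestorsᶠ zero x = x ∷ []
  ancestorsᶠ (suc d) x = x ∷ ancestorsᶠ d (parent x)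

  ancestors : Fin n → List (Fin n)
  ancestors x = ancestorsᶠ (depth x) x

  ancestors-parent : ∀ {x} → x ≢ ρ → ancestors x ≡ x ∷ ancestors (parent x)
  ancestors-parent {x} x≢ρ = cong (λ d → ancestorsᶠ d x) (depth-parent x≢ρ)

  InSubtree : Fin n → Fin n → Set
  InSubtree v x = v ∈ ancestors x

  InSubtree? : ∀ v x → Dec (InSubtree v x)
  InSubtree? v x = v ∈? ancestors x

  InSubtree-refl : ∀ v → InSubtree v v
  InSubtree-refl v with depth v
  ... | zero = here refl
  ... | suc _ = here refl

  InSubtree-root : ∀ {v} → InSubtree v ρ → v ≡ ρ
  InSubtree-root v∈ancestors with subst (λ d → _ ∈ ancestorsᶠ d ρ) depth-root v∈ancestors
  ... | here v≡ρ = v≡ρ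

  InSubtree-child : ∀ {v x y} → (y , x) ∈ treeEdges → InSubtree v x → InSubtree v y
  InSubtree-child yx∈E v∈ancestors with ∈-treeEdges⁻ yx∈E
  ... | y≢ρ , refl = subst (_ ∈_) (sym (ancestors-parent y≢ρ)) (there v∈ancestors)

  InSubtree-parent : ∀ {v x y} → (x , y) ∈ treeEdges → x ≢ v → InSubtree v x → InSubtree v y
  InSubtree-parent xy∈E x≢v v∈ancestors with ∈-treeEdges⁻ xy∈E
  ... | x≢ρ , refl with subst (_ ∈_) (ancestors-parent x≢ρ) v∈ancestors
  ...   | here v≡x = ⊥-elim (x≢v (sym v≡x))
  ...   | there v∈ancestors′ = v∈ancestors′

module Tree {n : ℕ} (T : Graph n) (tree : IsTree T) where

  private
    connected : Connected T
    connected = proj₁ tree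
    acyclic : Acyclic T
    acyclic = proj₂ tree

  -- Adjacency in T is not decidable, so breadth-first search runs on the finite list of
  -- edges used by the connecting walks.
  opaque
    edgesFrom : Fin n → List (Edge n)
    edgesFrom u = concatMap (λ v → edges (connected u v)) (allFin n)

    walkEdges : List (Edge n)
    walkEdges = concatMap edgesFrom (allFin n)

    walkEdges-adj : All (λ e → Adj T (proj₁ e) (proj₂ e)) walkEdges
    walkEdges-adj = All.concat⁺ (All.map⁺ {xs = allFin n} (All.tabulate λ {u} _ →
                      All.concat⁺ (All.map⁺ {xs = allFin n}
                        (All.tabulate λ {v} _ → edges-steps (connected u v)))))

    walkEdges-connected : ∀ u v → Walk (InEdges walkEdges) u v
    walkEdges-connected u v = walkAlong (connected u v) λ e∈p →
      ∈-concatMap⁺ edgesFrom (lose (∈-allFin u) (∈-concatMap⁺ _ (lose (∈-allFin v) e∈p)))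

  walkEdges⇒Adj : ∀ {x y} → InEdges walkEdges x y → Adj T x y
  walkEdges⇒Adj (fwd xy∈F) = All.lookup walkEdges-adj xy∈F
  walkEdges⇒Adj (bwd yx∈F) = Graph.sym T (All.lookup walkEdges-adj yx∈F)

  module Rooted (ρ : Fin n) where

    opaque
      bfsTree : Arborescence (InEdges walkEdges) ρ
      bfsTree = BreadthFirst.arborescence InEdges? ρ (λ v → walkEdges-connected v ρ)

    open Arborescence bfsTree
    open ArborescenceProperties bfsTree

    treeEdges-isEdgeSet : IsEdgeSet T treeEdges
    treeEdges-isEdgeSet = treeEdges-edgeSet {G = T} walkEdges⇒Adj

    treeEdges⇒Adj : ∀ {x y} → InEdges treeEdges x y → Adj T x y
    treeEdges⇒Adj = InEdges⇒Adj {G = T} treeEdges-isEdgeSet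

    spanningConnector : ∀ S → SteinerConn T S (n ∸ 1)
    spanningConnector S =
      treeEdges , treeEdges-isEdgeSet , length-treeEdges , λ u v _ _ → treeEdges-connected u v

    private
      shortPath⇒edge : ∀ {x y} → Adj T x y → (q : Walk (InEdges treeEdges) y x) →
                       length (verts q) ≤ 2 → InEdges treeEdges x y
      shortPath⇒edge x~x here _ = ⊥-elim (Graph.irrefl T x~x)
      shortPath⇒edge _ (step e here) _ = InEdges-sym e
      shortPath⇒edge _ (step _ (step _ here)) (s≤s (s≤s ()))
      shortPath⇒edge _ (step _ (step _ (step _ _))) (s≤s (s≤s ()))

    -- The tree path from y to x closes a cycle with the edge x — y unless it is that edge.
    Adj⇒treeEdge : ∀ {x y} → Adj T x y → InEdges treeEdges x y
    Adj⇒treeEdge {x} {y} x~y with toPath (treeEdges-connected y x)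
    ... | q , q-path = shortPath⇒edge x~y q (subst (λ vs → length vs ≤ 2) (verts-mapʷ treeEdges⇒Adj q)
                         (acyclic x y x~y (mapʷ treeEdges⇒Adj q)
                           (subst Unique (sym (verts-mapʷ treeEdges⇒Adj q)) q-path)))

    -- A deepest vertex of the subtree of v has no children.
    leafInSubtree : ∀ {v} → v ≢ ρ → ∃ λ u → InSubtree v u × IsLeaf T u
    leafInSubtree {v} v≢ρ = u , u∈subtree , parent u , walkEdges⇒Adj (parent-step u≢ρ) , onlyParent
      where
      subtree : List (Fin n)
      subtree = filter (InSubtree? v) (allFin n)
      u : Fin n
      u = argmax depth v subtree
      u∈subtree : InSubtree v u
      u∈subtree = argmax-all depth (InSubtree-refl v)
                    (All.tabulate λ x∈ → proj₂ (∈-filter⁻ (InSubtree? v) {xs = allFin n} x∈))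
      deepest : ∀ {x} → InSubtree v x → depth x ≤ depth u
      deepest x∈subtree = All.lookup (f[xs]≤f[argmax] v subtree)
                            (∈-filter⁺ (InSubtree? v) (∈-allFin _) x∈subtree)
      u≢ρ : u ≢ ρ
      u≢ρ u≡ρ = v≢ρ (InSubtree-root (subst (InSubtree v) u≡ρ u∈subtree))
      onlyParent : ∀ y → Adj T u y → y ≡ parent u
      onlyParent y u~y with Adj⇒treeEdge u~y
      ... | fwd uy∈E = proj₂ (∈-treeEdges⁻ uy∈E)
      ... | bwd yu∈E = ⊥-elim (1+n≰n (subst (_≤ depth u) (treeEdge-depth yu∈E)
                             (deepest (InSubtree-child yu∈E u∈subtree))))

    -- The only edge of T leaving the subtree of v is v — parent v.
    exitSubtree : ∀ {H} → (∀ {x y} → InEdges H x y → Adj T x y) → ∀ {v x} → v ≢ ρ →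
                  InSubtree v x → Walk (InEdges H) x ρ → InEdges H v (parent v)
    exitSubtree _ v≢ρ x∈subtree here = ⊥-elim (v≢ρ (InSubtree-root x∈subtree))
    exitSubtree {H} H⇒Adj {v} {x} v≢ρ x∈subtree (step {v = y} e p) with InSubtree? v y
    ... | yes y∈subtree = exitSubtree H⇒Adj v≢ρ y∈subtree p
    ... | no y∉subtree with Adj⇒treeEdge (H⇒Adj e)
    ...   | bwd yx∈E = ⊥-elim (y∉subtree (InSubtree-child yx∈E x∈subtree))
    ...   | fwd xy∈E with x ≟ v
    ...     | yes refl = subst (InEdges H v) (proj₂ (∈-treeEdges⁻ xy∈E)) e
    ...     | no x≢v = ⊥-elim (y∉subtree (InSubtree-parent xy∈E x≢v x∈subtree))

    connector-length : ∀ {S m} → ρ ∈ S → (∀ v → IsLeaf T v → v ∈ S) → SteinerConn T S m → n ∸ 1 ≤ m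
    connector-length ρ∈S leaves⊆S (H , H-edgeSet , refl , H-joins) = parentEdges⊆⇒length≥ covers
      where
      covers : ∀ {v} → v ≢ ρ → InEdges H v (parent v)
      covers v≢ρ with leafInSubtree v≢ρ
      ... | u , u∈subtree , u-leaf =
        exitSubtree (InEdges⇒Adj {G = T} H-edgeSet) v≢ρ u∈subtree (H-joins u ρ (leaves⊆S u u-leaf) ρ∈S)

    leaf∉⇒shorterConnector : ∀ {S ℓ} → IsLeaf T ℓ → ℓ ∉ S → Σ ℕ λ m → m < n ∸ 1 × SteinerConn T S m
    leaf∉⇒shorterConnector {S} {ℓ} (w , ℓ~w , onlyW) ℓ∉S =
      length E′ , |E′|<n∸1 , E′ , IsEdgeSet-filter {G = T} (avoids? ℓ) treeEdges-isEdgeSet , refl , joins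
      where
      E′ : List (Edge n)
      E′ = filter (avoids? ℓ) treeEdges
      touching : Any (λ e → ¬ Avoids ℓ e) treeEdges
      touching with Adj⇒treeEdge ℓ~w
      ... | fwd ℓw∈E = lose ℓw∈E (λ (ℓ≢ℓ , _) → ℓ≢ℓ refl)
      ... | bwd wℓ∈E = lose wℓ∈E (λ (_ , ℓ≢ℓ) → ℓ≢ℓ refl)
      |E′|<n∸1 : length E′ < n ∸ 1
      |E′|<n∸1 = subst (length E′ <_) length-treeEdges (filter-notAll (avoids? ℓ) treeEdges touching)
      joins : ∀ u v → u ∈ S → v ∈ S → Walk (InEdges E′) u v
      joins u v u∈S v∈S = bypass ℓ (λ e → onlyW _ (treeEdges⇒Adj e)) (treeEdges-connected u v)
                            (λ u≡ℓ → ℓ∉S (subst (_∈ S) u≡ℓ u∈S)) (λ v≡ℓ → ℓ∉S (subst (_∈ S) v≡ℓ v∈S))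

    steinerDist≤n∸1 : ∀ {S d} → SteinerDist T S d → d ≤ n ∸ 1
    steinerDist≤n∸1 {S} (_ , minimal) = ≮⇒≥ λ n∸1<d → minimal (n ∸ 1) n∸1<d (spanningConnector S)

    steinerDist≡n∸1⇒leaf∈ : ∀ {S ℓ} → SteinerDist T S (n ∸ 1) → IsLeaf T ℓ → ℓ ∈ S
    steinerDist≡n∸1⇒leaf∈ {S} {ℓ} (_ , minimal) ℓ-leaf with ℓ ∈? S
    ... | yes ℓ∈S = ℓ∈S
    ... | no ℓ∉S with leaf∉⇒shorterConnector ℓ-leaf ℓ∉S
    ...   | m , m<n∸1 , connector = ⊥-elim (minimal m m<n∸1 connector)

    leaves⊆⇒steinerDist≡n∸1 : ∀ {S} → ρ ∈ S → (∀ v → IsLeaf T v → v ∈ S) → SteinerDist T S (n ∸ 1)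
    leaves⊆⇒steinerDist≡n∸1 {S} ρ∈S leaves⊆S =
      spanningConnector S , λ m m<n∸1 connector → <⇒≱ m<n∸1 (connector-length ρ∈S leaves⊆S connector)

lemma1 : (k n r : ℕ) → 2 ≤ k → k ≤ n → (T : Graph n) → IsTree T → NumLeaves T r →
    (SteinerDiam T k (n ∸ 1) ⇔ r ≤ k)
lemma1 _ zero _ (s≤s (s≤s _)) () _ _ _
lemma1 k n@(suc _) r 2≤k k≤n T tree (L , L-unique , |L|≡r , L⊆leaves , leaves⊆L) =
  mk⇔ diameter⇒r≤k r≤k⇒diameter
  where
  open Tree T tree
  open Rooted zero using (steinerDist≤n∸1; steinerDist≡n∸1⇒leaf∈)

  diameter⇒r≤k : SteinerDiam T k (n ∸ 1) → r ≤ k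
  diameter⇒r≤k ((S , (_ , |S|≡k) , S-dist) , _) = subst₂ _≤_ |L|≡r |S|≡k
    (unique-⊆⇒length≤ L-unique λ {v} v∈L → steinerDist≡n∸1⇒leaf∈ S-dist (L⊆leaves v v∈L))

  r≤k⇒diameter : r ≤ k → SteinerDiam T k (n ∸ 1)
  r≤k⇒diameter r≤k with extendToKSubset L-unique (subst (_≤ k) (sym |L|≡r) r≤k) k≤n
  ... | [] , (_ , 0≡k) , _ = ⊥-elim (<⇒≱ (≤-trans (s≤s z≤n) 2≤k) (≤-reflexive (sym 0≡k)))
  ... | S@(ρ ∷ _) , S-kSubset , L⊆S =
      (S , S-kSubset , Rooted.leaves⊆⇒steinerDist≡n∸1 ρ (here refl) λ v v-leaf → L⊆S (leaves⊆L v v-leaf))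
    , λ _ _ _ → steinerDist≤n∸1
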